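{- Let $[\alpha,\beta]$ be a maximal free interval of $w_0$. Then there are intervals $[\gamma,\delta]$ and $[\gamma',\delta']$ with $[\alpha,\beta]\approx[\gamma,\delta]\approx[\gamma',\delta']$ such that $\gamma$ and $\delta'$ are cuts.
   Context: Let $\Gamma_0$ be a finite alphabet with involution $a\mapsto\overline a$ (fixed points allowed), extended to words by $\overline{a_1\cdots a_k}=\overline{a_k}\cdots\overline{a_1}$, and $\Omega_0$ a finite set of variables with fixed-point-free involution. Let $x_1,\dots,x_d\in\Gamma_0\cup\Omega_0$ with $2\le g<d$, and let $\sigma:\Omega_0\to\Gamma_0^*$ with $\sigma(\overline X)=\overline{\sigma(X)}$ (extended to a homomorphism fixing $\Gamma_0$) satisfy $\sigma(x_1\cdots x_g)=\sigma(x_{g+1}\cdots x_d)=:w_0$ and $\sigma(x_i)\ne1$ for all $i$. Let $m_0=|w_0|$. Positions of $w=a_1\cdots a_m$ are $0,\dots,m$; for $0\le\alpha<\beta\le m$ set $w[\alpha,\beta]=a_{\alpha+1}\cdots a_\beta$, $w[\beta,\alpha]=\overline{w[\alpha,\beta]}$, $w[\alpha,\alpha]=1$; an interval is any pair $[\alpha,\beta]$ of positions. For $1\le i\le g$ let $\mathrm{l}(i)=|\sigma(x_1\cdots x_{i-1})|$, for $g<i\le d$ let $\mathrm{l}(i)=|\sigma(x_{g+1}\cdots x_{i-1})|$, and $\mathrm{r}(i)=\mathrm{l}(i)+|\sigma(x_i)|$. The cuts are the positions $\mathrm{l}(i),\mathrm{r}(i)$, $1\le i\le d$. For $i,j$ and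 $\mu,\nu\in\{0,\dots,\mathrm{r}(i)-\mathrm{l}(i)\}$ define $[\mathrm{l}(i)+\mu,\mathrm{l}(i)+\nu]\sim[\mathrm{l}(j)+\mu,\mathrm{l}(j)+\nu]$ if $x_i=x_j$, and $[\mathrm{l}(i)+\mu,\mathrm{l}(i)+\nu]\sim[\mathrm{r}(j)-\mu,\mathrm{r}(j)-\nu]$ if $x_i=\overline{x_j}$; let $\approx$ be the reflexive transitive closure of $\sim$. An interval $[\alpha,\beta]$ is free if for every $[\alpha',\beta']\approx[\alpha,\beta]$ there is no cut $\gamma'$ with $\min\{\alpha',\beta'\}<\gamma'<\max\{\alpha',\beta'\}$. A free interval $[\alpha,\beta]$ is maximal free if there is no free interval $[\alpha',\beta']$ with $\alpha'\le\min\{\alpha,\beta\}\le\max\{\alpha,\beta\}\le\beta'$ and $\beta'-\alpha'>|\beta-\alpha|$. -}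

module Defs where

open import Data.Nat using (ℕ; _+_; _∸_; _≤_; _<_; _<?_; ∣_-_∣; _⊓_; _⊔_)
open import Data.Fin using (Fin; toℕ)
open import Data.List using (List; []; _∷_; [_]; length; take; drop; concatMap; reverse; map; tabulate)
open import Data.Sum using (_⊎_; inj₁; inj₂)
open import Data.Product using (_×_; _,_; ∃; ∃-syntax; Σ-syntax)
open import Data.Bool using (if_then_else_)
open import Relation.Nullary using (¬_)
open import Relation.Nullary.Decidable using (⌊_⌋)
open import Relation.Binary.PropositionalEquality using (_≡_)
open import Relation.Binary.Construct.Closure.ReflexiveTransitive using (Star)

-- Γ₀ = Fin nΓ (constants) with involution barΓ; Ω₀ = Fin nΩ (variables)
-- with involution barΩ.  Letters are elements of Γ₀ ⊎ Ω₀.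
Letter : ℕ → ℕ → Set
Letter nΓ nΩ = Fin nΓ ⊎ Fin nΩ

Interval : Set
Interval = ℕ × ℕ

-- The unknowns x₁ … x_d are indexed 0 … d-1 (so index i corresponds to x_{i+1});
-- the left side is x₀ … x_{g-1}, the right side x_g … x_{d-1}.
module Equation (nΓ nΩ : ℕ) (barΓ : Fin nΓ → Fin nΓ) (barΩ : Fin nΩ → Fin nΩ)
                (d g : ℕ) (x : Fin d → Letter nΓ nΩ)
                (σ : Fin nΩ → List (Fin nΓ)) where

  barL : Letter nΓ nΩ → Letter nΓ nΩ
  barL (inj₁ a) = inj₁ (barΓ a)
  barL (inj₂ X) = inj₂ (barΩ X)

  σL : Letter nΓ nΩ → List (Fin nΓ)
  σL (inj₁ a) = [ a ]
  σL (inj₂ X) = σ X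

  σW : List (Letter nΓ nΩ) → List (Fin nΓ)
  σW = concatMap σL

  xs : List (Letter nΓ nΩ)
  xs = tabulate x

  leftSide : List (Letter nΓ nΩ)
  leftSide = take g xs

  rightSide : List (Letter nΓ nΩ)
  rightSide = drop g xs

  w₀ : List (Fin nΓ)
  w₀ = σW leftSide

  m₀ : ℕ
  m₀ = length w₀

  l : Fin d → ℕ
  l i = if ⌊ toℕ i <? g ⌋
          then length (σW (take (toℕ i) xs))
          else length (σW (drop g (take (toℕ i) xs)))

  len : Fin d → ℕ
  len i = length (σL (x i))

  r : Fin d → ℕ
  r i = l i + len i

  IsCut : ℕ → Set
  IsCut γ = ∃[ i ] (γ ≡ l i ⊎ γ ≡ r i)

  _∼_ : Interval → Interval → Set
  (a , b) ∼ (c , e) =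
    ∃[ i ] ∃[ j ] ∃[ μ ] ∃[ ν ] (μ ≤ len i × ν ≤ len i ×
      ( (x i ≡ x j × a ≡ l i + μ × b ≡ l i + ν × c ≡ l j + μ × e ≡ l j + ν)
      ⊎ (x i ≡ barL (x j) × a ≡ l i + μ × b ≡ l i + ν × c ≡ r j ∸ μ × e ≡ r j ∸ ν)))

  _≈_ : Interval → Interval → Set
  _≈_ = Star _∼_

  IsPosition : ℕ → Set
  IsPosition α = α ≤ m₀

  IsInterval : Interval → Set
  IsInterval (α , β) = IsPosition α × IsPosition β

  Free : Interval → Set
  Free I = ∀ α' β' → I ≈ (α' , β') →
             ¬ (∃[ γ' ] (IsCut γ' × (α' ⊓ β') < γ' × γ' < (α' ⊔ β')))

  MaximalFree : Interval → Set
  MaximalFree (α , β) =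
    IsInterval (α , β) × Free (α , β) ×
    ¬ (∃[ α' ] ∃[ β' ] (IsInterval (α' , β') × Free (α' , β') ×
         α' ≤ (α ⊓ β) × (α ⊔ β) ≤ β' × ∣ β - α ∣ < β' ∸ α'))

-- Suppose no interval ≈-equivalent to [α, β] begins at a cut.  Then moving α one step
-- away from β keeps the interval free: every instance of ∼ translates or reflects offsets
-- inside some σ(x_i), so each ≈-image of the stretched interval is the stretch of an
-- ≈-image of [α, β], and a cut strictly inside it lies strictly inside that image or at
-- its first endpoint.  As 0 and m₀ are cuts, the stretched interval stays within w₀,
-- contradicting maximality.  Since ∼ has finitely many instances, it is decidable whether
-- some ≈-image begins at a cut, so the contradiction yields one; the same argument for
-- [β, α] yields an image ending at a cut.
{-# OPTIONS --safe #-}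
module Submission where

open import Defs
open import Data.Nat using (ℕ; zero; suc; _+_; _∸_; _≤_; _<_; _≟_; _≤?_; _<?_; z≤n; s≤s; _⊓_; _⊔_)
open import Data.Nat.Properties
  using ( ≤-refl; ≤-reflexive; ≤-trans; <-trans; <⇒≤; ≰⇒>; ≤∧≢⇒<; n≮n; n≤1+n; n<1+n; m≤n⇒m≤1+n
        ; m≤n⇒m<n∨m≡n; m<1+n⇒m<n∨m≡n; m≤m+n; m≤n+m; suc-injective; +-suc; +-identityʳ
        ; +-mono-≤; +-mono-<-≤; +-mono-≤-<; +-monoʳ-≤; +-monoʳ-<; +-cancelˡ-≤; +-cancelˡ-<
        ; m∸n≤m; ∸-monoʳ-≤; ∸-monoʳ-<; +-∸-assoc; m∸[m∸n]≡n
        ; ⊓-comm; ⊔-comm; m≤n⇒m⊓n≡m; m≥n⇒m⊓n≡n; m≤n⇒m⊔n≡n; m≥n⇒m⊔n≡m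
        ; ∣-∣-comm; m≤n⇒∣m-n∣≡n∸m; m≤n⇒∣n-m∣≡n∸m )
open import Data.Nat.Induction using (<-wellFounded)
open import Data.Fin using (Fin; toℕ; fromℕ<)
open import Data.Fin.Properties using (toℕ-fromℕ<)
import Data.Fin.Properties as Fin
open import Data.List
  using (List; []; _∷_; [_]; _++_; _∷ʳ_; length; take; map; reverse; concatMap; upTo; allFin; cartesianProduct; filter)
open import Data.List.Properties
  using (length-map; length-reverse; length-++; ++-identityʳ; concatMap-++; take-suc-tabulate)
open import Data.List.Membership.Propositional using (_∈_; _∉_; find; lose)
open import Data.List.Membership.Propositional.Properties
  using (∈-map⁺; ∈-map⁻; ∈-filter⁺; ∈-filter⁻; ∈-concatMap⁺; ∈-cartesianProduct⁺; ∈-upTo⁺; ∈-allFin)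
open import Data.List.Relation.Unary.Any using (Any; here; there; any?)
open import Data.List.Relation.Unary.All as All using (All; []; _∷_)
open import Data.Product using (_×_; _,_; proj₁; proj₂; swap; ∃-syntax; Σ-syntax)
import Data.Product.Properties as Product
open import Data.Sum using (_⊎_; inj₁; inj₂)
import Data.Sum.Properties as Sum
open import Function using (_∘_)
open import Induction.WellFounded using (Acc; acc)
open import Level using (0ℓ)
open import Relation.Binary using (Rel; DecidableEquality)
open import Relation.Binary.Construct.Closure.ReflexiveTransitive using (Star; ε; _◅_; _◅◅_; gmap)
import Relation.Binary.Construct.Closure.ReflexiveTransitive as Star
open import Relation.Binary.PropositionalEquality
  using (_≡_; _≢_; refl; sym; trans; cong; cong₂; subst; subst₂; module ≡-Reasoning)
open import Relation.Nullary using (¬_; Dec; yes; no; contradiction)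
open import Relation.Nullary.Decidable using (_×-dec_; _⊎-dec_; ¬?; map′)
open import Relation.Unary using (Pred; Decidable)

module Reachability {A : Set} (_≟ᴬ_ : DecidableEquality A) (_⟶_ : Rel A 0ℓ)
    (edges : List (A × A))
    (edge⇒⟶ : ∀ {a b} → (a , b) ∈ edges → a ⟶ b)
    (⟶⇒edge : ∀ {a b} → a ⟶ b → (a , b) ∈ edges) where

  open import Data.List.Membership.DecPropositional _≟ᴬ_ using (_∈?_)

  absent : {P : Set} → Dec P → ℕ
  absent (yes _) = 0
  absent (no _)  = 1

  absent-mono : {P Q : Set} → (P → Q) → (p? : Dec P) (q? : Dec Q) → absent q? ≤ absent p?
  absent-mono _   _       (yes _) = z≤n
  absent-mono _   (no _)  (no _)  = s≤s z≤n
  absent-mono p⇒q (yes p) (no ¬q) = contradiction (p⇒q p) ¬q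

  absent-< : {P Q : Set} → ¬ P → Q → (p? : Dec P) (q? : Dec Q) → absent q? < absent p?
  absent-< ¬p _ (yes p) _       = contradiction p ¬p
  absent-< _  q (no _)  (yes _) = s≤s z≤n
  absent-< _  q (no _)  (no ¬q) = contradiction q ¬q

  outside : List A → List A → ℕ
  outside vs []       = 0
  outside vs (b ∷ bs) = absent (b ∈? vs) + outside vs bs

  outside-∷-≤ : ∀ v vs bs → outside (v ∷ vs) bs ≤ outside vs bs
  outside-∷-≤ v vs []       = z≤n
  outside-∷-≤ v vs (b ∷ bs) =
    +-mono-≤ (absent-mono there (b ∈? vs) (b ∈? (v ∷ vs))) (outside-∷-≤ v vs bs)

  outside-∷-< : ∀ {b vs bs} → b ∈ bs → b ∉ vs → outside (b ∷ vs) bs < outside vs bs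
  outside-∷-< {b} {vs} {_ ∷ bs} (here refl) b∉vs =
    +-mono-<-≤ (absent-< b∉vs (here refl) (b ∈? vs) (b ∈? (b ∷ vs))) (outside-∷-≤ b vs bs)
  outside-∷-< {b} {vs} {c ∷ _} (there b∈bs) b∉vs =
    +-mono-≤-< (absent-mono there (c ∈? vs) (c ∈? (b ∷ vs))) (outside-∷-< b∈bs b∉vs)

  Closed : List A → Set
  Closed vs = ∀ {a b} → a ∈ vs → a ⟶ b → b ∈ vs

  Leaving : List A → A × A → Set
  Leaving vs (a , b) = a ∈ vs × b ∉ vs

  leaving? : ∀ vs → Decidable (Leaving vs)
  leaving? vs (a , b) = (a ∈? vs) ×-dec ¬? (b ∈? vs)

  closed : ∀ {vs} → ¬ Any (Leaving vs) edges → Closed vs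
  closed {vs} nothing-leaves {b = b} a∈vs a⟶b with b ∈? vs
  ... | yes b∈vs = b∈vs
  ... | no b∉vs  = contradiction (lose (⟶⇒edge a⟶b) (a∈vs , b∉vs)) nothing-leaves

  saturate : ∀ {s} vs → All (Star _⟶_ s) vs → s ∈ vs → Acc _<_ (outside vs (map proj₂ edges)) →
             Σ[ ws ∈ List A ] (All (Star _⟶_ s) ws × s ∈ ws × Closed ws)
  saturate vs reach s∈vs (acc smaller) with any? (leaving? vs) edges
  ... | no nothing-leaves = vs , reach , s∈vs , closed nothing-leaves
  ... | yes leaves =
    let (a , b) , e∈edges , a∈vs , b∉vs = find leaves
    in saturate (b ∷ vs) ((All.lookup reach a∈vs ◅◅ edge⇒⟶ e∈edges ◅ ε) ∷ reach) (there s∈vs)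
                (smaller (outside-∷-< (∈-map⁺ proj₂ e∈edges) b∉vs))

  closed-⋆ : ∀ {ws a b} → Closed ws → a ∈ ws → Star _⟶_ a b → b ∈ ws
  closed-⋆ _      a∈ws ε            = a∈ws
  closed-⋆ closed a∈ws (a⟶c ◅ c⟶⋆b) = closed-⋆ closed (closed a∈ws a⟶c) c⟶⋆b

  reachable? : {P : Pred A 0ℓ} → Decidable P → ∀ s → Dec (∃[ b ] (Star _⟶_ s b × P b))
  reachable? P? s =
    let ws , reach , s∈ws , ws-closed = saturate [ s ] (ε ∷ []) (here refl) (<-wellFounded _)
    in map′ (λ found → let b , b∈ws , Pb = find found in b , All.lookup reach b∈ws , Pb)
            (λ (b , s⟶⋆b , Pb) → lose (closed-⋆ ws-closed s∈ws s⟶⋆b) Pb)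
            (any? P? ws)


_⊕_ : ℕ → Interval → Interval
c ⊕ (μ , ν) = c + μ , c + ν

_⊖_ : ℕ → Interval → Interval
c ⊖ (μ , ν) = c ∸ μ , c ∸ ν

Within : ℕ → Interval → Set
Within n (μ , ν) = μ ≤ n × ν ≤ n

Inside : ℕ → Interval → Set
Inside γ (a , b) = a ⊓ b < γ × γ < a ⊔ b

within-≤ : ∀ {m n o} → Within m o → m ≤ n → Within n o
within-≤ (μ≤m , ν≤m) m≤n = ≤-trans μ≤m m≤n , ≤-trans ν≤m m≤n

within-⊖ : ∀ n o → Within n (n ⊖ o)
within-⊖ n (μ , ν) = m∸n≤m n μ , m∸n≤m n ν

⊕-⊖ : ∀ c {n o} → Within n o → c ⊕ (n ⊖ o) ≡ (c + n) ⊖ o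
⊕-⊖ c (μ≤n , ν≤n) = sym (cong₂ _,_ (+-∸-assoc c μ≤n) (+-∸-assoc c ν≤n))

+-∸-∸ : ∀ c {n κ} → κ ≤ n → (c + n) ∸ (n ∸ κ) ≡ c + κ
+-∸-∸ c {n} {κ} κ≤n = trans (+-∸-assoc c (m∸n≤m n κ)) (cong (c +_) (m∸[m∸n]≡n κ≤n))

⊖-⊖ : ∀ c {n o} → Within n o → (c + n) ⊖ (n ⊖ o) ≡ c ⊕ o
⊖-⊖ c (μ≤n , ν≤n) = cong₂ _,_ (+-∸-∸ c μ≤n) (+-∸-∸ c ν≤n)

inside-swap : ∀ {γ a b} → Inside γ (a , b) → Inside γ (b , a)
inside-swap {a = a} {b} (lo , hi) = subst (_< _) (⊓-comm a b) lo , subst (_ <_) (⊔-comm a b) hi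

inside-≤ : ∀ {γ a b} → a ≤ b → Inside γ (a , b) → a < γ × γ < b
inside-≤ a≤b (lo , hi) = subst (_< _) (m≤n⇒m⊓n≡m a≤b) lo , subst (_ <_) (m≤n⇒m⊔n≡n a≤b) hi

inside-≤⁻ : ∀ {γ a b} → a ≤ b → a < γ × γ < b → Inside γ (a , b)
inside-≤⁻ a≤b (lo , hi) = subst (_< _) (sym (m≤n⇒m⊓n≡m a≤b)) lo , subst (_ <_) (sym (m≤n⇒m⊔n≡n a≤b)) hi

-- The endpoints are related by equations rather than by indices so that a stretch
-- can be matched against intervals such as  l i ⊕ o.
data Stretch : Interval → Interval → Set where
  stretch-up   : ∀ {a a' b} → b ≤ a → a' ≡ suc a → Stretch (a , b) (a' , b)
  stretch-down : ∀ {a a' b} → a' < b → a ≡ suc a' → Stretch (a , b) (a' , b)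

stretch-inside : ∀ {γ p q} → Stretch p q → Inside γ q → Inside γ p ⊎ γ ≡ proj₁ p
stretch-inside (stretch-up b≤a refl) γ∈q
  with b<γ , γ<1+a ← inside-≤ (m≤n⇒m≤1+n b≤a) (inside-swap γ∈q)
  with m<1+n⇒m<n∨m≡n γ<1+a
... | inj₁ γ<a = inj₁ (inside-swap (inside-≤⁻ b≤a (b<γ , γ<a)))
... | inj₂ γ≡a = inj₂ γ≡a
stretch-inside (stretch-down a<b refl) γ∈q
  with a<γ , γ<b ← inside-≤ (<⇒≤ a<b) γ∈q
  with m≤n⇒m<n∨m≡n a<γ
... | inj₁ 1+a<γ = inj₁ (inside-≤⁻ a<b (1+a<γ , γ<b))
... | inj₂ 1+a≡γ = inj₂ (sym 1+a≡γ)

stretch-within : ∀ {n o o'} → Stretch o o' → Within n o' → Within n o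
stretch-within (stretch-up _ refl)   (1+a≤n , b≤n) = <⇒≤ 1+a≤n , b≤n
stretch-within (stretch-down a<b refl) (_ , b≤n)   = ≤-trans a<b b≤n , b≤n

stretch-⊕ : ∀ c {o o'} → Stretch o o' → Stretch (c ⊕ o) (c ⊕ o')
stretch-⊕ c (stretch-up b≤a refl)   = stretch-up (+-monoʳ-≤ c b≤a) (+-suc c _)
stretch-⊕ c (stretch-down a<b refl) = stretch-down (+-monoʳ-< c a<b) (+-suc c _)

stretch-⊖ : ∀ c {o o'} → Within c o' → Stretch o o' → Stretch (c ⊖ o) (c ⊖ o')
stretch-⊖ c (1+a≤c , _) (stretch-up b≤a refl) =
  stretch-down (∸-monoʳ-< (s≤s b≤a) 1+a≤c) (+-∸-assoc 1 1+a≤c)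
stretch-⊖ c (_ , b≤c) (stretch-down a<b refl) =
  stretch-up (∸-monoʳ-≤ c a<b) (+-∸-assoc 1 (≤-trans a<b b≤c))

stretch-⊕⁻¹ : ∀ c {p μ' ν'} → Stretch p (c + μ' , c + ν') → ∃[ o ] (p ≡ c ⊕ o × Stretch o (μ' , ν'))
stretch-⊕⁻¹ c {μ' = zero} {ν'} (stretch-up {a} c+ν'≤a c+0≡1+a) =
  contradiction (subst (_≤ a) (trans (sym (+-identityʳ c)) c+0≡1+a) (≤-trans (m≤m+n c ν') c+ν'≤a)) (n≮n a)
stretch-⊕⁻¹ c {μ' = suc μ} {ν'} (stretch-up c+ν'≤a c+1+μ≡1+a)
  with refl ← suc-injective (trans (sym (+-suc c μ)) c+1+μ≡1+a)
  = (μ , ν') , refl , stretch-up (+-cancelˡ-≤ c ν' μ c+ν'≤a) refl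
stretch-⊕⁻¹ c {μ' = μ'} {ν'} (stretch-down c+μ'<c+ν' refl) =
  (suc μ' , ν') , cong (_, c + ν') (sym (+-suc c μ')) , stretch-down (+-cancelˡ-< c μ' ν' c+μ'<c+ν') refl


module MaximalFreeIntervals
    (nΓ nΩ : ℕ) (barΓ : Fin nΓ → Fin nΓ) (barΩ : Fin nΩ → Fin nΩ)
    (d g : ℕ) (x : Fin d → Letter nΓ nΩ) (σ : Fin nΩ → List (Fin nΓ))
    (barΓ-involutive : ∀ a → barΓ (barΓ a) ≡ a)
    (barΩ-involutive : ∀ X → barΩ (barΩ X) ≡ X)
    (0<g : 0 < g) (g<d : g < d)
    (σ-bar : ∀ X → σ (barΩ X) ≡ reverse (map barΓ (σ X))) where

  open Equation nΓ nΩ barΓ barΩ d g x σ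

  barL-involutive : ∀ y → barL (barL y) ≡ y
  barL-involutive (inj₁ a) = cong inj₁ (barΓ-involutive a)
  barL-involutive (inj₂ X) = cong inj₂ (barΩ-involutive X)

  length-σL-barL : ∀ y → length (σL (barL y)) ≡ length (σL y)
  length-σL-barL (inj₁ a) = refl
  length-σL-barL (inj₂ X) = begin
    length (σ (barΩ X))                 ≡⟨ cong length (σ-bar X) ⟩
    length (reverse (map barΓ (σ X)))   ≡⟨ length-reverse (map barΓ (σ X)) ⟩
    length (map barΓ (σ X))             ≡⟨ length-map barΓ (σ X) ⟩
    length (σ X)                        ∎
    where open ≡-Reasoning

  l-lhs : ∀ i → toℕ i < g → l i ≡ length (σW (take (toℕ i) xs))
  l-lhs i i<g with toℕ i <? g
  ... | yes _   = refl
  ... | no i≮g = contradiction i<g i≮g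

  length-σW-∷ʳ : ∀ ys y → length (σW (ys ∷ʳ y)) ≡ length (σW ys) + length (σL y)
  length-σW-∷ʳ ys y = begin
    length (σW (ys ∷ʳ y))                   ≡⟨ cong length (concatMap-++ σL ys [ y ]) ⟩
    length (σW ys ++ σL y ++ [])             ≡⟨ length-++ (σW ys) ⟩
    length (σW ys) + length (σL y ++ [])     ≡⟨ cong (λ zs → length (σW ys) + length zs) (++-identityʳ (σL y)) ⟩
    length (σW ys) + length (σL y)           ∎
    where open ≡-Reasoning

  r-lhs : ∀ i → toℕ i < g → r i ≡ length (σW (take (suc (toℕ i)) xs))
  r-lhs i i<g = begin
    l i + len i                                ≡⟨ cong (_+ len i) (l-lhs i i<g) ⟩
    length (σW (take (toℕ i) xs)) + len i      ≡⟨ length-σW-∷ʳ (take (toℕ i) xs) (x i) ⟨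
    length (σW (take (toℕ i) xs ∷ʳ x i))       ≡⟨ cong (length ∘ σW) (take-suc-tabulate x i) ⟨
    length (σW (take (suc (toℕ i)) xs))        ∎
    where open ≡-Reasoning

  lhs-cuts : ∀ {k} → k < g → IsCut (length (σW (take k xs))) × IsCut (length (σW (take (suc k) xs)))
  lhs-cuts k<g with fromℕ< (<-trans k<g g<d) | toℕ-fromℕ< (<-trans k<g g<d)
  ... | i | refl = (i , inj₁ (sym (l-lhs i k<g))) , (i , inj₂ (sym (r-lhs i k<g)))

  prefix-cut : ∀ k → k ≤ g → IsCut (length (σW (take k xs)))
  prefix-cut zero    _   = proj₁ (lhs-cuts 0<g)
  prefix-cut (suc k) k<g = proj₂ (lhs-cuts k<g)

  IsCut? : ∀ γ → Dec (IsCut γ)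
  IsCut? γ = Fin.any? (λ i → (γ ≟ l i) ⊎-dec (γ ≟ r i))

  data Direction : Set where
    forward backward : Direction

  Matches : Direction → Fin d → Fin d → Set
  Matches forward  i j = x i ≡ x j
  Matches backward i j = x i ≡ barL (x j)

  _≟ₗ_ : DecidableEquality (Letter nΓ nΩ)
  _≟ₗ_ = Sum.≡-dec Fin._≟_ Fin._≟_

  matches? : ∀ dir i j → Dec (Matches dir i j)
  matches? forward  i j = x i ≟ₗ x j
  matches? backward i j = x i ≟ₗ barL (x j)

  matches-sym : ∀ dir {i j} → Matches dir i j → Matches dir j i
  matches-sym forward  xi≡xj = sym xi≡xj
  matches-sym backward {j = j} xi≡x̄j = sym (trans (cong barL xi≡x̄j) (barL-involutive (x j)))

  matches-len : ∀ dir {i j} → Matches dir i j → len i ≡ len j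
  matches-len forward  xi≡xj = cong (length ∘ σL) xi≡xj
  matches-len backward {j = j} xi≡x̄j = trans (cong (length ∘ σL) xi≡x̄j) (length-σL-barL (x j))

  Move : Set
  Move = Fin d × Fin d × Interval × Direction

  source : Move → Interval
  source (i , _ , o , _) = l i ⊕ o

  target : Move → Interval
  target (_ , j , o , forward)  = l j ⊕ o
  target (_ , j , o , backward) = r j ⊖ o

  Legal : Move → Set
  Legal (i , j , o , dir) = Within (len i) o × Matches dir i j

  legal? : ∀ m → Dec (Legal m)
  legal? (i , j , (μ , ν) , dir) = ((μ ≤? len i) ×-dec (ν ≤? len i)) ×-dec matches? dir i j

  move⇒∼ : ∀ m → Legal m → source m ∼ target m
  move⇒∼ (i , j , (μ , ν) , forward)  ((μ≤ , ν≤) , xi≡xj) = i , j , μ , ν , μ≤ , ν≤ , inj₁ (xi≡xj , refl , refl , refl , refl)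
  move⇒∼ (i , j , (μ , ν) , backward) ((μ≤ , ν≤) , xi≡x̄j) = i , j , μ , ν , μ≤ , ν≤ , inj₂ (xi≡x̄j , refl , refl , refl , refl)

  ∼⇒move : ∀ {p q} → p ∼ q → ∃[ m ] (Legal m × source m ≡ p × target m ≡ q)
  ∼⇒move {_ , _} {_ , _} (i , j , μ , ν , μ≤ , ν≤ , inj₁ (xi≡xj , refl , refl , refl , refl)) =
    (i , j , (μ , ν) , forward) , ((μ≤ , ν≤) , xi≡xj) , refl , refl
  ∼⇒move {_ , _} {_ , _} (i , j , μ , ν , μ≤ , ν≤ , inj₂ (xi≡x̄j , refl , refl , refl , refl)) =
    (i , j , (μ , ν) , backward) , ((μ≤ , ν≤) , xi≡x̄j) , refl , refl

  move-inverse : ∀ m → Legal m → ∃[ m' ] (Legal m' × source m' ≡ target m × target m' ≡ source m)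
  move-inverse (i , j , o , forward) (o≤ , xi≡xj) =
    (j , i , o , forward) , (subst (λ n → Within n o) (matches-len forward xi≡xj) o≤ , sym xi≡xj) , refl , refl
  move-inverse (i , j , o , backward) (o≤ , xi≡x̄j) =
    (j , i , len j ⊖ o , backward) , (within-⊖ (len j) o , matches-sym backward xi≡x̄j) ,
    ⊕-⊖ (l j) (subst (λ n → Within n o) len-i≡len-j o≤) ,
    subst (λ n → r i ⊖ (n ⊖ o) ≡ l i ⊕ o) len-i≡len-j (⊖-⊖ (l i) o≤)
    where len-i≡len-j = matches-len backward xi≡x̄j

  ∼-sym : ∀ {p q} → p ∼ q → q ∼ p
  ∼-sym p∼q with ∼⇒move p∼q
  ... | m , legal , refl , refl with move-inverse m legal
  ... | m' , legal' , m'-source , m'-target = subst₂ _∼_ m'-source m'-target (move⇒∼ m' legal')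

  ∼-swap : ∀ {p q} → p ∼ q → swap p ∼ swap q
  ∼-swap {_ , _} {_ , _} (i , j , μ , ν , μ≤ , ν≤ , inj₁ (xi≡xj , a≡ , b≡ , c≡ , e≡)) =
    i , j , ν , μ , ν≤ , μ≤ , inj₁ (xi≡xj , b≡ , a≡ , e≡ , c≡)
  ∼-swap {_ , _} {_ , _} (i , j , μ , ν , μ≤ , ν≤ , inj₂ (xi≡x̄j , a≡ , b≡ , c≡ , e≡)) =
    i , j , ν , μ , ν≤ , μ≤ , inj₂ (xi≡x̄j , b≡ , a≡ , e≡ , c≡)

  ≈-sym : ∀ {p q} → p ≈ q → q ≈ p
  ≈-sym = Star.reverse ∼-sym

  ≈-swap : ∀ {p q} → p ≈ q → swap p ≈ swap q
  ≈-swap = gmap swap ∼-swap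

  movesFrom : Fin d → List Move
  movesFrom i = map (i ,_) (cartesianProduct (allFin d) (cartesianProduct (cartesianProduct range range) (forward ∷ backward ∷ [])))
    where range = upTo (suc (len i))

  moves : List Move
  moves = concatMap movesFrom (allFin d)

  legal-∈-moves : ∀ m → Legal m → m ∈ moves
  legal-∈-moves (i , j , (μ , ν) , dir) ((μ≤ , ν≤) , _) =
    ∈-concatMap⁺ movesFrom (lose (∈-allFin i) (∈-map⁺ (i ,_) (∈-cartesianProduct⁺ (∈-allFin j)
      (∈-cartesianProduct⁺ (∈-cartesianProduct⁺ (∈-upTo⁺ (s≤s μ≤)) (∈-upTo⁺ (s≤s ν≤))) (direction-∈ dir)))))
    where
    direction-∈ : ∀ dir → dir ∈ forward ∷ backward ∷ []
    direction-∈ forward  = here refl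
    direction-∈ backward = there (here refl)

  edge : Move → Interval × Interval
  edge m = source m , target m

  edges : List (Interval × Interval)
  edges = map edge (filter legal? moves)

  edge⇒∼ : ∀ {p q} → (p , q) ∈ edges → p ∼ q
  edge⇒∼ e∈edges with ∈-map⁻ edge e∈edges
  ... | m , m∈legal , refl = move⇒∼ m (proj₂ (∈-filter⁻ legal? {xs = moves} m∈legal))

  ∼⇒edge : ∀ {p q} → p ∼ q → (p , q) ∈ edges
  ∼⇒edge p∼q with ∼⇒move p∼q
  ... | m , legal , refl , refl = ∈-map⁺ edge (∈-filter⁺ legal? (legal-∈-moves m legal) legal)

  open Reachability (Product.≡-dec _≟_ _≟_) _∼_ edges edge⇒∼ ∼⇒edge using (reachable?)

  target-stretch : ∀ {i j o o'} dir → Matches dir i j → Within (len i) o' → Stretch o o' →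
                   Stretch (target (i , j , o , dir)) (target (i , j , o' , dir))
  target-stretch {j = j} forward  _      _   o⇝o' = stretch-⊕ (l j) o⇝o'
  target-stretch {j = j} backward xi≡x̄j o'≤ o⇝o' =
    stretch-⊖ (r j) (within-≤ o'≤ (subst (_≤ r j) (sym (matches-len backward xi≡x̄j)) (m≤n+m (len j) (l j)))) o⇝o'

  ∼-stretch : ∀ {p q q'} → Stretch p q → q ∼ q' → ∃[ p' ] (p ∼ p' × Stretch p' q')
  ∼-stretch p⇝q q∼q' with ∼⇒move q∼q'
  ... | (i , j , (μ' , ν') , dir) , (o'≤ , match) , refl , refl with stretch-⊕⁻¹ (l i) p⇝q
  ... | o , refl , o⇝o' =
    target (i , j , o , dir) , move⇒∼ (i , j , o , dir) (stretch-within o⇝o' o'≤ , match) ,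
    target-stretch dir match o'≤ o⇝o'

  ≈-stretch : ∀ {p q q'} → Stretch p q → q ≈ q' → ∃[ p' ] (p ≈ p' × Stretch p' q')
  ≈-stretch p⇝q ε = _ , ε , p⇝q
  ≈-stretch p⇝q (q∼q₁ ◅ q₁≈q') with ∼-stretch p⇝q q∼q₁
  ... | p₁ , p∼p₁ , p₁⇝q₁ with ≈-stretch p₁⇝q₁ q₁≈q'
  ... | p' , p₁≈p' , p'⇝q' = p' , p∼p₁ ◅ p₁≈p' , p'⇝q'

  CutAtStart : Interval → Set
  CutAtStart p = ∃[ y ] (p ≈ y × IsCut (proj₁ y))

  free-swap : ∀ {a b} → Free (a , b) → Free (b , a)
  free-swap free α' β' b,a≈α',β' (γ , γ-cut , γ-inside) =
    free β' α' (≈-swap b,a≈α',β') (γ , γ-cut , inside-swap γ-inside)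

  stretch-free : ∀ {p q} → Free p → ¬ CutAtStart p → Stretch p q → Free q
  stretch-free free no-cut p⇝q α' β' q≈α',β' (γ , γ-cut , γ-inside) with ≈-stretch p⇝q q≈α',β'
  ... | (a , b) , p≈a,b , a,b⇝α',β' with stretch-inside a,b⇝α',β' γ-inside
  ...   | inj₁ γ-inside-a,b = free a b p≈a,b (γ , γ-cut , γ-inside-a,b)
  ...   | inj₂ refl         = no-cut ((γ , b) , p≈a,b , γ-cut)

  maximalFree-swap : ∀ {α β} → MaximalFree (α , β) → MaximalFree (β , α)
  maximalFree-swap {α} {β} ((α≤m₀ , β≤m₀) , free , maximal) =
    (β≤m₀ , α≤m₀) , free-swap free ,
    λ (α' , β' , interval , free' , α'≤ , ≤β' , wider) →
      maximal (α' , β' , interval , free' , subst (α' ≤_) (⊓-comm β α) α'≤ ,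
               subst (_≤ β') (⊔-comm β α) ≤β' , subst (_< β' ∸ α') (∣-∣-comm α β) wider)

  stretch-not-free : ∀ {p q} → Stretch p q → MaximalFree p → IsInterval q → ¬ Free q
  stretch-not-free (stretch-up {a} {b = b} b≤a refl) (_ , _ , maximal) (1+a≤m₀ , b≤m₀) free =
    maximal (b , suc a , (b≤m₀ , 1+a≤m₀) , free-swap free ,
             ≤-reflexive (sym (m≥n⇒m⊓n≡n b≤a)) , ≤-trans (≤-reflexive (m≥n⇒m⊔n≡m b≤a)) (n≤1+n a) ,
             subst₂ _<_ (sym (m≤n⇒∣m-n∣≡n∸m b≤a)) (sym (+-∸-assoc 1 b≤a)) (n<1+n (a ∸ b)))
  stretch-not-free (stretch-down {a' = a} {b} a<b refl) (_ , _ , maximal) (a≤m₀ , b≤m₀) free =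
    maximal (a , b , (a≤m₀ , b≤m₀) , free ,
             ≤-trans (n≤1+n a) (≤-reflexive (sym (m≤n⇒m⊓n≡m a<b))) , ≤-reflexive (m≤n⇒m⊔n≡n a<b) ,
             subst (_< b ∸ a) (sym (m≤n⇒∣n-m∣≡n∸m a<b)) (∸-monoʳ-< (n<1+n a) a<b))

  stretchable : ∀ {α β} → IsInterval (α , β) → ¬ IsCut α → ∃[ q ] (Stretch (α , β) q × IsInterval q)
  stretchable {α} {β} (α≤m₀ , β≤m₀) α-uncut with β ≤? α
  ... | yes β≤α = (suc α , β) , stretch-up β≤α refl , ≤∧≢⇒< α≤m₀ α≢m₀ , β≤m₀
    where
    α≢m₀ : α ≢ m₀
    α≢m₀ refl = α-uncut (prefix-cut g ≤-refl)
  stretchable {zero} _ 0-uncut | no _ = contradiction (prefix-cut 0 z≤n) 0-uncut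
  stretchable {suc k} {β} (1+k≤m₀ , β≤m₀) _ | no β≰1+k =
    (k , β) , stretch-down (<⇒≤ (≰⇒> β≰1+k)) refl , <⇒≤ 1+k≤m₀ , β≤m₀

  cut-at-start : ∀ {α β} → MaximalFree (α , β) → CutAtStart (α , β)
  cut-at-start {α} {β} maximal@(interval , free , _) with reachable? (IsCut? ∘ proj₁) (α , β)
  ... | yes cut   = cut
  ... | no no-cut =
    let q , α,β⇝q , q-interval = stretchable interval (λ α-cut → no-cut ((α , β) , ε , α-cut))
    in contradiction (stretch-free free no-cut α,β⇝q) (stretch-not-free α,β⇝q maximal q-interval)

  cut-at-end : ∀ {α β} → MaximalFree (α , β) → ∃[ y ] ((α , β) ≈ y × IsCut (proj₂ y))
  cut-at-end maximal =
    let y , β,α≈y , cut = cut-at-start (maximalFree-swap maximal)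
    in swap y , ≈-swap β,α≈y , cut


lemma12 : (nΓ nΩ : ℕ) (barΓ : Fin nΓ → Fin nΓ) (barΩ : Fin nΩ → Fin nΩ)
          (d g : ℕ) (x : Fin d → Letter nΓ nΩ) (σ : Fin nΩ → List (Fin nΓ)) →
          (∀ a → barΓ (barΓ a) ≡ a) →
          (∀ X → barΩ (barΩ X) ≡ X) →
          (∀ X → barΩ X ≢ X) →
          2 ≤ g → g < d →
          (∀ X → σ (barΩ X) ≡ reverse (map barΓ (σ X))) →
          Equation.σW nΓ nΩ barΓ barΩ d g x σ (Equation.leftSide nΓ nΩ barΓ barΩ d g x σ)
            ≡ Equation.σW nΓ nΩ barΓ barΩ d g x σ (Equation.rightSide nΓ nΩ barΓ barΩ d g x σ) →
          (∀ i → Equation.σL nΓ nΩ barΓ barΩ d g x σ (x i) ≢ []) →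
          ∀ α β → Equation.MaximalFree nΓ nΩ barΓ barΩ d g x σ (α , β) →
          ∃[ γ ] ∃[ δ ] ∃[ γ' ] ∃[ δ' ]
            (Equation._≈_ nΓ nΩ barΓ barΩ d g x σ (α , β) (γ , δ) ×
             Equation._≈_ nΓ nΩ barΓ barΩ d g x σ (γ , δ) (γ' , δ') ×
             Equation.IsCut nΓ nΩ barΓ barΩ d g x σ γ ×
             Equation.IsCut nΓ nΩ barΓ barΩ d g x σ δ')
lemma12 nΓ nΩ barΓ barΩ d g x σ barΓ-involutive barΩ-involutive _ 2≤g g<d σ-bar _ _ α β maximal =
  let (γ , δ) , α,β≈γ,δ , γ-cut = cut-at-start maximal
      (γ' , δ') , α,β≈γ',δ' , δ'-cut = cut-at-end maximal
  in γ , δ , γ' , δ' , α,β≈γ,δ , ≈-sym α,β≈γ,δ ◅◅ α,β≈γ',δ' , γ-cut , δ'-cut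
  where
  open MaximalFreeIntervals nΓ nΩ barΓ barΩ d g x σ barΓ-involutive barΩ-involutive
         (≤-trans (s≤s z≤n) 2≤g) g<d σ-bar
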